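{- The theory $T_{1} + \mathrm{IND}(\forall_1(\mathcal{L}_{1}))$ proves \[ Y \frown X = Z \frown X \rightarrow Y = Z. \]
   Context: The language $\mathcal{L}_{1}$ has sorts $\mathsf{i}$ and $\mathsf{list}$, function symbols $\mathit{nil}:\mathsf{list}$, $\mathit{cons}:\mathsf{i}\times\mathsf{list}\to\mathsf{list}$ and infix $\frown:\mathsf{list}\times\mathsf{list}\to\mathsf{list}$ (many-sorted first-order logic with equality). $T_{1}$ is axiomatized by the universal closures of: $\mathit{nil}\neq\mathit{cons}(x,X)$; $\mathit{cons}(x,X)=\mathit{cons}(y,Y)\rightarrow x=y\wedge X=Y$; $\mathit{nil}\frown Y=Y$; $\mathit{cons}(x,X)\frown Y=\mathit{cons}(x,X\frown Y)$. For a formula $\varphi(X,\vec z)$, $I_X\varphi$ is $\big(\varphi(\mathit{nil},\vec z)\wedge\forall X\,\forall x\,(\varphi(X,\vec z)\rightarrow\varphi(\mathit{cons}(x,X),\vec z))\big)\rightarrow\forall X\,\varphi(X,\vec z)$; $\mathrm{IND}(\Phi)$ is axiomatized by the universal closures of $I_X\varphi$ for $\varphi\in\Phi$. $\forall_1(\mathcal L_1)$ is the set of $\mathcal L_1$-formulas $\forall\vec x\,\psi$ with $\psi$ quantifier-free and $\vec x$ a possibly empty sequence of variables. -}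

module Defs where

open import Data.List using (List; []; _∷_; map)
open import Data.List.Membership.Propositional using (_∈_)

data Sort : Set where
  ι lst : Sort

Ctx : Set
Ctx = List Sort

infix 4 _∋_
data _∋_ : Ctx → Sort → Set where
  here  : ∀ {Γ s} → (s ∷ Γ) ∋ s
  there : ∀ {Γ s t} → Γ ∋ s → (t ∷ Γ) ∋ s

infixr 6 _⌢_
data Tm (Γ : Ctx) : Sort → Set where
  var  : ∀ {s} → Γ ∋ s → Tm Γ s
  nil  : Tm Γ lst
  cons : Tm Γ ι → Tm Γ lst → Tm Γ lst
  _⌢_  : Tm Γ lst → Tm Γ lst → Tm Γ lst

infix 5 _≐_
infixr 3 _⇒_
infixr 4 _∨̇_
infixr 5 _∧̇_
data Fm (Γ : Ctx) : Set where
  ⊥̇   : Fm Γ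
  _≐_ : ∀ {s} → Tm Γ s → Tm Γ s → Fm Γ
  _⇒_ : Fm Γ → Fm Γ → Fm Γ
  _∧̇_ : Fm Γ → Fm Γ → Fm Γ
  _∨̇_ : Fm Γ → Fm Γ → Fm Γ
  all : (s : Sort) → Fm (s ∷ Γ) → Fm Γ
  ex  : (s : Sort) → Fm (s ∷ Γ) → Fm Γ

¬̇_ : ∀ {Γ} → Fm Γ → Fm Γ
¬̇ φ = φ ⇒ ⊥̇

Ren : Ctx → Ctx → Set
Ren Γ Δ = ∀ {s} → Γ ∋ s → Δ ∋ s

liftR : ∀ {Γ Δ s} → Ren Γ Δ → Ren (s ∷ Γ) (s ∷ Δ)
liftR ρ here      = here
liftR ρ (there v) = there (ρ v)

renT : ∀ {Γ Δ s} → Ren Γ Δ → Tm Γ s → Tm Δ s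
renT ρ (var v)    = var (ρ v)
renT ρ nil        = nil
renT ρ (cons x X) = cons (renT ρ x) (renT ρ X)
renT ρ (X ⌢ Y)    = renT ρ X ⌢ renT ρ Y

renF : ∀ {Γ Δ} → Ren Γ Δ → Fm Γ → Fm Δ
renF ρ ⊥̇       = ⊥̇
renF ρ (t ≐ u) = renT ρ t ≐ renT ρ u
renF ρ (φ ⇒ ψ) = renF ρ φ ⇒ renF ρ ψ
renF ρ (φ ∧̇ ψ) = renF ρ φ ∧̇ renF ρ ψ
renF ρ (φ ∨̇ ψ) = renF ρ φ ∨̇ renF ρ ψ
renF ρ (all s φ) = all s (renF (liftR ρ) φ)
renF ρ (ex s φ)  = ex s (renF (liftR ρ) φ)

wkF : ∀ {Γ s} → Fm Γ → Fm (s ∷ Γ)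
wkF = renF there

Sub : Ctx → Ctx → Set
Sub Γ Δ = ∀ {s} → Γ ∋ s → Tm Δ s

liftS : ∀ {Γ Δ s} → Sub Γ Δ → Sub (s ∷ Γ) (s ∷ Δ)
liftS σ here      = var here
liftS σ (there v) = renT there (σ v)

subT : ∀ {Γ Δ s} → Sub Γ Δ → Tm Γ s → Tm Δ s
subT σ (var v)    = σ v
subT σ nil        = nil
subT σ (cons x X) = cons (subT σ x) (subT σ X)
subT σ (X ⌢ Y)    = subT σ X ⌢ subT σ Y

subF : ∀ {Γ Δ} → Sub Γ Δ → Fm Γ → Fm Δ
subF σ ⊥̇       = ⊥̇
subF σ (t ≐ u) = subT σ t ≐ subT σ u
subF σ (φ ⇒ ψ) = subF σ φ ⇒ subF σ ψ
subF σ (φ ∧̇ ψ) = subF σ φ ∧̇ subF σ ψ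
subF σ (φ ∨̇ ψ) = subF σ φ ∨̇ subF σ ψ
subF σ (all s φ) = all s (subF (liftS σ) φ)
subF σ (ex s φ)  = ex s (subF (liftS σ) φ)

sub1 : ∀ {Γ s} → Tm Γ s → Sub (s ∷ Γ) Γ
sub1 t here      = t
sub1 t (there v) = var v

_[_] : ∀ {Γ s} → Fm (s ∷ Γ) → Tm Γ s → Fm Γ
φ [ t ] = subF (sub1 t) φ

emptyR : ∀ {Γ} → Ren [] Γ
emptyR ()

∀* : (Γ : Ctx) → Fm Γ → Fm []
∀* []      φ = φ
∀* (s ∷ Γ) φ = ∀* Γ (all s φ)

data QF {Γ} : Fm Γ → Set where
  qf⊥ : QF ⊥̇
  qf≐ : ∀ {s} {t u : Tm Γ s} → QF (t ≐ u)
  qf⇒ : ∀ {φ ψ} → QF φ → QF ψ → QF (φ ⇒ ψ)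
  qf∧ : ∀ {φ ψ} → QF φ → QF ψ → QF (φ ∧̇ ψ)
  qf∨ : ∀ {φ ψ} → QF φ → QF ψ → QF (φ ∨̇ ψ)

data Univ₁ : ∀ {Γ} → Fm Γ → Set where
  base : ∀ {Γ} {φ : Fm Γ} → QF φ → Univ₁ φ
  all₁ : ∀ {Γ s} {φ : Fm (s ∷ Γ)} → Univ₁ φ → Univ₁ (all s φ)

-- Induction formula I_X φ, for φ(X, z⃗) : Fm (lst ∷ Γ), X = index 0.
-- Step: ∀X ∀x (φ(X) → φ(cons(x, X))); in context ι ∷ lst ∷ Γ,
-- x = index 0 and X = index 1.
stepPre : ∀ {Γ} → Sub (lst ∷ Γ) (ι ∷ lst ∷ Γ)
stepPre here      = var (there here)
stepPre (there v) = var (there (there v))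

stepPost : ∀ {Γ} → Sub (lst ∷ Γ) (ι ∷ lst ∷ Γ)
stepPost here      = cons (var here) (var (there here))
stepPost (there v) = var (there (there v))

Ind : ∀ {Γ} → Fm (lst ∷ Γ) → Fm Γ
Ind φ = (φ [ nil ] ∧̇ all lst (all ι (subF stepPre φ ⇒ subF stepPost φ)))
        ⇒ all lst φ

v0 : ∀ {Γ s} → Tm (s ∷ Γ) s
v0 = var here
v1 : ∀ {Γ s t} → Tm (t ∷ s ∷ Γ) s
v1 = var (there here)
v2 : ∀ {Γ s t u} → Tm (u ∷ t ∷ s ∷ Γ) s
v2 = var (there (there here))
v3 : ∀ {Γ s t u w} → Tm (w ∷ u ∷ t ∷ s ∷ Γ) s
v3 = var (there (there (there here)))

data T₁+IND∀₁ : Fm [] → Set where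
  ax-nil≠cons : T₁+IND∀₁ (∀* (ι ∷ lst ∷ []) (¬̇ (nil ≐ cons v0 v1)))
  -- cons(x,X) = cons(y,Y) → x = y ∧ X = Y   (context: x, X, y, Y)
  ax-cons-inj : T₁+IND∀₁ (∀* (ι ∷ lst ∷ ι ∷ lst ∷ [])
                   (cons v0 v1 ≐ cons v2 v3 ⇒ (v0 ≐ v2) ∧̇ (v1 ≐ v3)))
  ax-⌢-nil    : T₁+IND∀₁ (∀* (lst ∷ []) (nil ⌢ v0 ≐ v0))
  -- cons(x,X) ⌢ Y = cons(x, X ⌢ Y)   (context: x, X, Y)
  ax-⌢-cons   : T₁+IND∀₁ (∀* (ι ∷ lst ∷ lst ∷ [])
                   (cons v0 v1 ⌢ v2 ≐ cons v0 (v1 ⌢ v2)))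
  ax-ind      : ∀ (Γ : Ctx) (φ : Fm (lst ∷ Γ)) → Univ₁ φ →
                T₁+IND∀₁ (∀* Γ (Ind φ))

infix 2 _⊢[_]_
data _⊢[_]_ {Γ : Ctx} (Δ : List (Fm Γ)) (T : Fm [] → Set) : Fm Γ → Set where
  ax   : ∀ {φ} → T φ → Δ ⊢[ T ] renF emptyR φ
  hyp  : ∀ {φ} → φ ∈ Δ → Δ ⊢[ T ] φ
  ⇒I   : ∀ {φ ψ} → (φ ∷ Δ) ⊢[ T ] ψ → Δ ⊢[ T ] φ ⇒ ψ
  ⇒E   : ∀ {φ ψ} → Δ ⊢[ T ] φ ⇒ ψ → Δ ⊢[ T ] φ → Δ ⊢[ T ] ψ
  ∧I   : ∀ {φ ψ} → Δ ⊢[ T ] φ → Δ ⊢[ T ] ψ → Δ ⊢[ T ] φ ∧̇ ψ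
  ∧E₁  : ∀ {φ ψ} → Δ ⊢[ T ] φ ∧̇ ψ → Δ ⊢[ T ] φ
  ∧E₂  : ∀ {φ ψ} → Δ ⊢[ T ] φ ∧̇ ψ → Δ ⊢[ T ] ψ
  ∨I₁  : ∀ {φ ψ} → Δ ⊢[ T ] φ → Δ ⊢[ T ] φ ∨̇ ψ
  ∨I₂  : ∀ {φ ψ} → Δ ⊢[ T ] ψ → Δ ⊢[ T ] φ ∨̇ ψ
  ∨E   : ∀ {φ ψ χ} → Δ ⊢[ T ] φ ∨̇ ψ → (φ ∷ Δ) ⊢[ T ] χ → (ψ ∷ Δ) ⊢[ T ] χ →
         Δ ⊢[ T ] χ
  raa  : ∀ {φ} → (¬̇ φ ∷ Δ) ⊢[ T ] ⊥̇ → Δ ⊢[ T ] φ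
  ∀I   : ∀ {s} {φ : Fm (s ∷ Γ)} → map wkF Δ ⊢[ T ] φ → Δ ⊢[ T ] all s φ
  ∀E   : ∀ {s} {φ : Fm (s ∷ Γ)} → Δ ⊢[ T ] all s φ → (t : Tm Γ s) →
         Δ ⊢[ T ] φ [ t ]
  ∃I   : ∀ {s} {φ : Fm (s ∷ Γ)} (t : Tm Γ s) → Δ ⊢[ T ] φ [ t ] →
         Δ ⊢[ T ] ex s φ
  ∃E   : ∀ {s} {φ : Fm (s ∷ Γ)} {ψ} → Δ ⊢[ T ] ex s φ →
         (φ ∷ map wkF Δ) ⊢[ T ] wkF ψ → Δ ⊢[ T ] ψ
  ≐refl  : ∀ {s} {t : Tm Γ s} → Δ ⊢[ T ] t ≐ t
  ≐subst : ∀ {s} (φ : Fm (s ∷ Γ)) {t u : Tm Γ s} → Δ ⊢[ T ] t ≐ u →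
           Δ ⊢[ T ] φ [ t ] → Δ ⊢[ T ] φ [ u ]

Proves : (Fm [] → Set) → Fm [] → Set
Proves T φ = [] ⊢[ T ] φ

-- Right cancellation is proved by induction on Y with Z universally quantified: for
-- Y = cons a Y' and Z = cons b Z', injectivity of cons reduces the claim to the
-- hypothesis for Y'.  The case Y = nil needs that Z ⌢ X = X forces Z = nil, again by
-- induction on X with Z universally quantified: if Z = cons b Z' and
-- Z ⌢ cons a X = cons a X, then (Z' ⌢ cons a nil) ⌢ X = X, so Z' ⌢ cons a nil = nil by the
-- hypothesis, contradicting nil ≠ cons.  Both induction formulas are ∀₁ because of the
-- quantified Z; all case distinctions are inductions whose hypothesis goes unused.

module Submission where

open import Data.List using (List; []; _∷_)
open import Data.List.Relation.Unary.Any using (here; there)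
open import Level using (0ℓ)
open import Relation.Binary.Bundles using (Setoid)
open import Relation.Binary.PropositionalEquality
  using (_≡_; refl; sym; trans; cong; cong₂; subst; subst₂)
import Relation.Binary.Reasoning.Setoid as SetoidReasoning
open import Defs

wkT : ∀ {Γ s t} → Tm Γ s → Tm (t ∷ Γ) s
wkT = renT there

infixl 5 _▸_
_▸_ : ∀ {Γ Δ s} → Sub Γ Δ → Tm Δ s → Sub (s ∷ Γ) Δ
(σ ▸ t) here      = t
(σ ▸ t) (there v) = σ v

∅ : ∀ {Γ} → Sub [] Γ
∅ ()

infixr 9 _⊚_
_⊚_ : ∀ {Γ Δ Θ} → Sub Δ Θ → Sub Γ Δ → Sub Γ Θ
(τ ⊚ σ) v = subT τ (σ v)

infix 4 _≗ₛ_
_≗ₛ_ : ∀ {Γ Δ} → Sub Γ Δ → Sub Γ Δ → Set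
σ ≗ₛ τ = ∀ {s} (v : _ ∋ s) → σ v ≡ τ v

liftS-cong : ∀ {Γ Δ s} {σ τ : Sub Γ Δ} → σ ≗ₛ τ → liftS {s = s} σ ≗ₛ liftS τ
liftS-cong eq here      = refl
liftS-cong eq (there v) = cong wkT (eq v)

subT-cong : ∀ {Γ Δ s} {σ τ : Sub Γ Δ} → σ ≗ₛ τ → (t : Tm Γ s) → subT σ t ≡ subT τ t
subT-cong eq (var v)    = eq v
subT-cong eq nil        = refl
subT-cong eq (cons x X) = cong₂ cons (subT-cong eq x) (subT-cong eq X)
subT-cong eq (X ⌢ Y)    = cong₂ _⌢_ (subT-cong eq X) (subT-cong eq Y)

subF-cong : ∀ {Γ Δ} {σ τ : Sub Γ Δ} → σ ≗ₛ τ → (φ : Fm Γ) → subF σ φ ≡ subF τ φ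
subF-cong eq ⊥̇         = refl
subF-cong eq (t ≐ u)   = cong₂ _≐_ (subT-cong eq t) (subT-cong eq u)
subF-cong eq (φ ⇒ ψ)   = cong₂ _⇒_ (subF-cong eq φ) (subF-cong eq ψ)
subF-cong eq (φ ∧̇ ψ)   = cong₂ _∧̇_ (subF-cong eq φ) (subF-cong eq ψ)
subF-cong eq (φ ∨̇ ψ)   = cong₂ _∨̇_ (subF-cong eq φ) (subF-cong eq ψ)
subF-cong eq (all s φ) = cong (all s) (subF-cong (liftS-cong eq) φ)
subF-cong eq (ex s φ)  = cong (ex s) (subF-cong (liftS-cong eq) φ)

infix 4 _≗ᵣ_
_≗ᵣ_ : ∀ {Γ Δ} → Sub Γ Δ → Ren Γ Δ → Set
σ ≗ᵣ ρ = ∀ {s} (v : _ ∋ s) → σ v ≡ var (ρ v)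

liftS-liftR : ∀ {Γ Δ s} {σ : Sub Γ Δ} {ρ : Ren Γ Δ} → σ ≗ᵣ ρ → liftS {s = s} σ ≗ᵣ liftR ρ
liftS-liftR eq here      = refl
liftS-liftR eq (there v) = cong wkT (eq v)

subT-renT : ∀ {Γ Δ s} {σ : Sub Γ Δ} {ρ : Ren Γ Δ} → σ ≗ᵣ ρ → (t : Tm Γ s) → subT σ t ≡ renT ρ t
subT-renT eq (var v)    = eq v
subT-renT eq nil        = refl
subT-renT eq (cons x X) = cong₂ cons (subT-renT eq x) (subT-renT eq X)
subT-renT eq (X ⌢ Y)    = cong₂ _⌢_ (subT-renT eq X) (subT-renT eq Y)

subF-renF : ∀ {Γ Δ} {σ : Sub Γ Δ} {ρ : Ren Γ Δ} → σ ≗ᵣ ρ → (φ : Fm Γ) → subF σ φ ≡ renF ρ φ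
subF-renF eq ⊥̇         = refl
subF-renF eq (t ≐ u)   = cong₂ _≐_ (subT-renT eq t) (subT-renT eq u)
subF-renF eq (φ ⇒ ψ)   = cong₂ _⇒_ (subF-renF eq φ) (subF-renF eq ψ)
subF-renF eq (φ ∧̇ ψ)   = cong₂ _∧̇_ (subF-renF eq φ) (subF-renF eq ψ)
subF-renF eq (φ ∨̇ ψ)   = cong₂ _∨̇_ (subF-renF eq φ) (subF-renF eq ψ)
subF-renF eq (all s φ) = cong (all s) (subF-renF (liftS-liftR eq) φ)
subF-renF eq (ex s φ)  = cong (ex s) (subF-renF (liftS-liftR eq) φ)

subT-liftS-wkT : ∀ {Γ Δ s t} (σ : Sub Γ Δ) (u : Tm Γ s) →
                 subT (liftS {s = t} σ) (wkT u) ≡ wkT (subT σ u)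
subT-liftS-wkT σ (var v)    = refl
subT-liftS-wkT σ nil        = refl
subT-liftS-wkT σ (cons x X) = cong₂ cons (subT-liftS-wkT σ x) (subT-liftS-wkT σ X)
subT-liftS-wkT σ (X ⌢ Y)    = cong₂ _⌢_ (subT-liftS-wkT σ X) (subT-liftS-wkT σ Y)

sub1-wkT : ∀ {Γ s t} (u : Tm Γ t) (w : Tm Γ s) → subT (sub1 u) (wkT w) ≡ w
sub1-wkT u (var v)    = refl
sub1-wkT u nil        = refl
sub1-wkT u (cons x X) = cong₂ cons (sub1-wkT u x) (sub1-wkT u X)
sub1-wkT u (X ⌢ Y)    = cong₂ _⌢_ (sub1-wkT u X) (sub1-wkT u Y)

liftS-⊚ : ∀ {Γ Δ Θ s} (τ : Sub Δ Θ) (σ : Sub Γ Δ) → liftS {s = s} τ ⊚ liftS σ ≗ₛ liftS (τ ⊚ σ)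
liftS-⊚ τ σ here      = refl
liftS-⊚ τ σ (there v) = subT-liftS-wkT τ (σ v)

subT-subT : ∀ {Γ Δ Θ s} (τ : Sub Δ Θ) (σ : Sub Γ Δ) (t : Tm Γ s) →
            subT τ (subT σ t) ≡ subT (τ ⊚ σ) t
subT-subT τ σ (var v)    = refl
subT-subT τ σ nil        = refl
subT-subT τ σ (cons x X) = cong₂ cons (subT-subT τ σ x) (subT-subT τ σ X)
subT-subT τ σ (X ⌢ Y)    = cong₂ _⌢_ (subT-subT τ σ X) (subT-subT τ σ Y)

subF-subF : ∀ {Γ Δ Θ} (τ : Sub Δ Θ) (σ : Sub Γ Δ) (φ : Fm Γ) →
            subF τ (subF σ φ) ≡ subF (τ ⊚ σ) φ
subF-subF τ σ ⊥̇         = refl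
subF-subF τ σ (t ≐ u)   = cong₂ _≐_ (subT-subT τ σ t) (subT-subT τ σ u)
subF-subF τ σ (φ ⇒ ψ)   = cong₂ _⇒_ (subF-subF τ σ φ) (subF-subF τ σ ψ)
subF-subF τ σ (φ ∧̇ ψ)   = cong₂ _∧̇_ (subF-subF τ σ φ) (subF-subF τ σ ψ)
subF-subF τ σ (φ ∨̇ ψ)   = cong₂ _∨̇_ (subF-subF τ σ φ) (subF-subF τ σ ψ)
subF-subF τ σ (all s φ) = cong (all s) (trans (subF-subF (liftS τ) (liftS σ) φ) (subF-cong (liftS-⊚ τ σ) φ))
subF-subF τ σ (ex s φ)  = cong (ex s) (trans (subF-subF (liftS τ) (liftS σ) φ) (subF-cong (liftS-⊚ τ σ) φ))

sub1-⊚-liftS : ∀ {Γ Δ s} (σ : Sub Γ Δ) (t : Tm Δ s) → sub1 t ⊚ liftS σ ≗ₛ σ ▸ t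
sub1-⊚-liftS σ t here      = refl
sub1-⊚-liftS σ t (there v) = sub1-wkT t (σ v)

subF-sub1-liftS : ∀ {Γ Δ s} (σ : Sub Γ Δ) (t : Tm Δ s) (φ : Fm (s ∷ Γ)) →
                  subF (liftS σ) φ [ t ] ≡ subF (σ ▸ t) φ
subF-sub1-liftS σ t φ = trans (subF-subF (sub1 t) (liftS σ) φ) (subF-cong (sub1-⊚-liftS σ t) φ)

▸-η : ∀ {Γ Δ s} (σ : Sub (s ∷ Γ) Δ) → (λ v → σ (there v)) ▸ σ here ≗ₛ σ
▸-η σ here      = refl
▸-η σ (there v) = refl

module _ {T : Fm [] → Set} {Γ : Ctx} {Δ : List (Fm Γ)} where

  conv : ∀ {φ ψ} → φ ≡ ψ → Δ ⊢[ T ] φ → Δ ⊢[ T ] ψ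
  conv = subst (Δ ⊢[ T ]_)

  ∀Eₛ : ∀ {Γ' s} {σ : Sub Γ' Γ} {φ : Fm (s ∷ Γ')} →
        Δ ⊢[ T ] subF σ (all s φ) → (t : Tm Γ s) → Δ ⊢[ T ] subF (σ ▸ t) φ
  ∀Eₛ {σ = σ} {φ} d t = conv (subF-sub1-liftS σ t φ) (∀E d t)

  ∀*E : ∀ {Γ'} {φ : Fm Γ'} → Δ ⊢[ T ] subF ∅ (∀* Γ' φ) → (σ : Sub Γ' Γ) → Δ ⊢[ T ] subF σ φ
  ∀*E {[]}     {φ} d σ = conv (subF-cong (λ ()) φ) d
  ∀*E {s ∷ Γ'} {φ} d σ = conv (subF-cong (▸-η σ) φ) (∀Eₛ {φ = φ} (∀*E d (λ v → σ (there v))) (σ here))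

  axiom : ∀ {Γ'} {φ : Fm Γ'} → T (∀* Γ' φ) → (σ : Sub Γ' Γ) → Δ ⊢[ T ] subF σ φ
  axiom t = ∀*E (conv (sym (subF-renF (λ ()) _)) (ax t))

  ⊥̇-elim : ∀ {φ} → Δ ⊢[ T ] ⊥̇ → Δ ⊢[ T ] φ
  ⊥̇-elim = ⇒E (⇒I (raa (hyp (there (here refl)))))

  ≐-sym : ∀ {s} {t u : Tm Γ s} → Δ ⊢[ T ] t ≐ u → Δ ⊢[ T ] u ≐ t
  ≐-sym {t = t} {u} p =
    conv (cong (u ≐_) (sub1-wkT u t))
      (≐subst (v0 ≐ wkT t) p (conv (cong (t ≐_) (sym (sub1-wkT t t))) ≐refl))

  ≐-substʳ : ∀ {s s'} {a : Tm Γ s'} {t u : Tm Γ s} (C : Tm (s ∷ Γ) s') → Δ ⊢[ T ] t ≐ u →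
             Δ ⊢[ T ] a ≐ subT (sub1 t) C → Δ ⊢[ T ] a ≐ subT (sub1 u) C
  ≐-substʳ {a = a} {t} {u} C p q =
    conv (cong (_≐ subT (sub1 u) C) (sub1-wkT u a))
      (≐subst (wkT a ≐ C) p (conv (cong (_≐ subT (sub1 t) C) (sym (sub1-wkT t a))) q))

  ≐-trans : ∀ {s} {t u w : Tm Γ s} → Δ ⊢[ T ] t ≐ u → Δ ⊢[ T ] u ≐ w → Δ ⊢[ T ] t ≐ w
  ≐-trans p q = ≐-substʳ v0 q p

  ≐-cong : ∀ {s s'} {t u : Tm Γ s} (C : Tm (s ∷ Γ) s') → Δ ⊢[ T ] t ≐ u →
           Δ ⊢[ T ] subT (sub1 t) C ≐ subT (sub1 u) C
  ≐-cong C p = ≐-substʳ C p ≐refl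

  cons-congˡ : ∀ {x y : Tm Γ ι} {X : Tm Γ lst} → Δ ⊢[ T ] x ≐ y → Δ ⊢[ T ] cons x X ≐ cons y X
  cons-congˡ {x} {y} {X} p =
    subst₂ (λ A B → Δ ⊢[ T ] cons x A ≐ cons y B) (sub1-wkT x X) (sub1-wkT y X)
      (≐-cong (cons v0 (wkT X)) p)

  cons-congʳ : ∀ {x : Tm Γ ι} {X Y : Tm Γ lst} → Δ ⊢[ T ] X ≐ Y → Δ ⊢[ T ] cons x X ≐ cons x Y
  cons-congʳ {x} {X} {Y} p =
    subst₂ (λ A B → Δ ⊢[ T ] cons A X ≐ cons B Y) (sub1-wkT X x) (sub1-wkT Y x)
      (≐-cong (cons (wkT x) v0) p)

  cons-cong : ∀ {x y : Tm Γ ι} {X Y : Tm Γ lst} → Δ ⊢[ T ] x ≐ y → Δ ⊢[ T ] X ≐ Y →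
              Δ ⊢[ T ] cons x X ≐ cons y Y
  cons-cong p q = ≐-trans (cons-congˡ p) (cons-congʳ q)

  ⌢-congˡ : ∀ {X X' Y : Tm Γ lst} → Δ ⊢[ T ] X ≐ X' → Δ ⊢[ T ] X ⌢ Y ≐ X' ⌢ Y
  ⌢-congˡ {X} {X'} {Y} p =
    subst₂ (λ A B → Δ ⊢[ T ] X ⌢ A ≐ X' ⌢ B) (sub1-wkT X Y) (sub1-wkT X' Y)
      (≐-cong (v0 ⌢ wkT Y) p)

  ⌢-congʳ : ∀ {X Y Y' : Tm Γ lst} → Δ ⊢[ T ] Y ≐ Y' → Δ ⊢[ T ] X ⌢ Y ≐ X ⌢ Y'
  ⌢-congʳ {X} {Y} {Y'} p =
    subst₂ (λ A B → Δ ⊢[ T ] A ⌢ Y ≐ B ⌢ Y') (sub1-wkT Y X) (sub1-wkT Y' X)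
      (≐-cong (wkT X ⌢ v0) p)

  ≐-setoid : Sort → Setoid 0ℓ 0ℓ
  ≐-setoid s = record
    { Carrier       = Tm Γ s
    ; _≈_           = λ t u → Δ ⊢[ T ] t ≐ u
    ; isEquivalence = record { refl = ≐refl ; sym = ≐-sym ; trans = ≐-trans }
    }

infix 2 _⊢_
_⊢_ : ∀ {Γ} → List (Fm Γ) → Fm Γ → Set
Δ ⊢ φ = Δ ⊢[ T₁+IND∀₁ ] φ

private
  variable
    Γ : Ctx
    Δ : List (Fm Γ)
    x y : Tm Γ ι
    X Y Z : Tm Γ lst

nil≢cons : Δ ⊢ nil ≐ cons x X → Δ ⊢ ⊥̇
nil≢cons {x = x} {X = X} = ⇒E (axiom ax-nil≠cons (∅ ▸ X ▸ x))

cons-injectiveˡ : Δ ⊢ cons x X ≐ cons y Y → Δ ⊢ x ≐ y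
cons-injectiveˡ {x = x} {X = X} {y = y} {Y = Y} p =
  ∧E₁ (⇒E (axiom ax-cons-inj (∅ ▸ Y ▸ y ▸ X ▸ x)) p)

cons-injectiveʳ : Δ ⊢ cons x X ≐ cons y Y → Δ ⊢ X ≐ Y
cons-injectiveʳ {x = x} {X = X} {y = y} {Y = Y} p =
  ∧E₂ (⇒E (axiom ax-cons-inj (∅ ▸ Y ▸ y ▸ X ▸ x)) p)

⌢-identityˡ : Δ ⊢ nil ⌢ X ≐ X
⌢-identityˡ {X = X} = axiom ax-⌢-nil (∅ ▸ X)

cons-⌢ : Δ ⊢ cons x X ⌢ Y ≐ cons x (X ⌢ Y)
cons-⌢ {x = x} {X = X} {Y = Y} = axiom ax-⌢-cons (∅ ▸ Y ▸ X ▸ x)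

induction : ∀ {Γ'} (φ : Fm (lst ∷ Γ')) → Univ₁ φ → (σ : Sub Γ' Γ) →
            Δ ⊢ subF σ (φ [ nil ]) →
            Δ ⊢ subF σ (all lst (all ι (subF stepPre φ ⇒ subF stepPost φ))) →
            (X : Tm Γ lst) → Δ ⊢ subF (σ ▸ X) φ
induction φ u σ nil-case cons-case =
  ∀Eₛ {φ = φ} (⇒E (axiom (ax-ind _ φ u) σ) (∧I nil-case cons-case))

⌢-identityʳ : Δ ⊢ X ⌢ nil ≐ X
⌢-identityʳ {X = X} = induction (v0 ⌢ nil ≐ v0) (base qf≐) ∅ ⌢-identityˡ
  (∀I (∀I (⇒I (≐-trans cons-⌢ (cons-congʳ (hyp (here refl))))))) X

module ≐-Reasoning {Γ : Ctx} (Δ : List (Fm Γ)) =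
  SetoidReasoning (≐-setoid {T = T₁+IND∀₁} {Δ = Δ} lst)

⌢-assoc : Δ ⊢ (X ⌢ Y) ⌢ Z ≐ X ⌢ (Y ⌢ Z)
⌢-assoc {X = X} {Y = Y} {Z = Z} =
  induction ((v0 ⌢ v1) ⌢ v2 ≐ v0 ⌢ (v1 ⌢ v2)) (base qf≐) (∅ ▸ Z ▸ Y)
    (≐-trans (⌢-congˡ ⌢-identityˡ) (≐-sym ⌢-identityˡ))
    (∀I (∀I (⇒I (assoc-cons (hyp (here refl)))))) X
  where
  assoc-cons : ∀ {Γ} {Δ : List (Fm Γ)} {x X Y Z} →
               Δ ⊢ (X ⌢ Y) ⌢ Z ≐ X ⌢ (Y ⌢ Z) → Δ ⊢ (cons x X ⌢ Y) ⌢ Z ≐ cons x X ⌢ (Y ⌢ Z)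
  assoc-cons {Δ = Δ} {x} {X} {Y} {Z} ih = begin
    (cons x X ⌢ Y) ⌢ Z   ≈⟨ ⌢-congˡ cons-⌢ ⟩
    cons x (X ⌢ Y) ⌢ Z   ≈⟨ cons-⌢ ⟩
    cons x ((X ⌢ Y) ⌢ Z) ≈⟨ cons-congʳ ih ⟩
    cons x (X ⌢ (Y ⌢ Z)) ≈⟨ cons-⌢ ⟨
    cons x X ⌢ (Y ⌢ Z)   ∎
    where open ≐-Reasoning Δ

nil≢⌢-cons : Δ ⊢ nil ≐ X ⌢ cons x Y → Δ ⊢ ⊥̇
nil≢⌢-cons {X = X} {x = x} {Y = Y} =
  ⇒E (induction (nil ≐ v0 ⌢ cons v1 v2 ⇒ ⊥̇) (base (qf⇒ qf≐ qf⊥)) (∅ ▸ Y ▸ x)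
        (⇒I (nil≢cons (≐-trans (hyp (here refl)) ⌢-identityˡ)))
        (∀I (∀I (⇒I (⇒I (nil≢cons (≐-trans (hyp (here refl)) cons-⌢)))))) X)

⌢-identityˡ-unique : Δ ⊢ Y ⌢ X ≐ X → Δ ⊢ Y ≐ nil
⌢-identityˡ-unique {Y = Y} {X = X} =
  ⇒E (∀Eₛ {σ = ∅ ▸ X} {φ = v0 ⌢ v1 ≐ v1 ⇒ v0 ≐ nil}
        (induction (all lst (v0 ⌢ v1 ≐ v1 ⇒ v0 ≐ nil)) (all₁ (base (qf⇒ qf≐ qf≐))) ∅
          nil-case cons-case X)
        Y)
  where
  nil-case : Δ ⊢ all lst (v0 ⌢ nil ≐ nil ⇒ v0 ≐ nil)
  nil-case = ∀I (⇒I (≐-trans (≐-sym ⌢-identityʳ) (hyp (here refl))))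

  shift : ∀ {Γ} {Δ : List (Fm Γ)} {x y X Y} →
          Δ ⊢ cons y Y ⌢ cons x X ≐ cons x X → Δ ⊢ (Y ⌢ cons x nil) ⌢ X ≐ X
  shift {Δ = Δ} {x} {y} {X} {Y} h = begin
    (Y ⌢ cons x nil) ⌢ X ≈⟨ ⌢-assoc ⟩
    Y ⌢ (cons x nil ⌢ X) ≈⟨ ⌢-congʳ (≐-trans cons-⌢ (cons-congʳ ⌢-identityˡ)) ⟩
    Y ⌢ cons x X         ≈⟨ cons-injectiveʳ (≐-trans (≐-sym cons-⌢) h) ⟩
    X                    ∎
    where open ≐-Reasoning Δ

  cons-case : Δ ⊢ all lst (all ι (all lst (v0 ⌢ v2 ≐ v2 ⇒ v0 ≐ nil) ⇒
                                  all lst (v0 ⌢ cons v1 v2 ≐ cons v1 v2 ⇒ v0 ≐ nil)))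
  cons-case = ∀I (∀I (⇒I (∀I
    (induction (v0 ⌢ cons v1 v2 ≐ cons v1 v2 ⇒ v0 ≐ nil) (base (qf⇒ qf≐ qf≐)) (∅ ▸ v2 ▸ v1)
      (⇒I ≐refl)
      (∀I (∀I (⇒I (⇒I (⊥̇-elim (nil≢⌢-cons (≐-sym
        (⇒E (∀E (hyp (there (there (here refl)))) (v1 ⌢ cons v3 nil))
            (shift (hyp (here refl)))))))))))
      v0))))

-- X is quantified in the induction formula too, although it never varies: the
-- hypothesis then mentions only variables, so its weakenings in cons-case compute.
⌢-cancelʳ : Δ ⊢ Y ⌢ X ≐ Z ⌢ X → Δ ⊢ Y ≐ Z
⌢-cancelʳ {Y = Y} {X = X} {Z = Z} =
  ⇒E (∀Eₛ {σ = ∅ ▸ Y ▸ X} {φ = v2 ⌢ v1 ≐ v0 ⌢ v1 ⇒ v2 ≐ v0}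
        (∀Eₛ {σ = ∅ ▸ Y} {φ = all lst (v2 ⌢ v1 ≐ v0 ⌢ v1 ⇒ v2 ≐ v0)}
          (induction (all lst (all lst (v2 ⌢ v1 ≐ v0 ⌢ v1 ⇒ v2 ≐ v0)))
                     (all₁ (all₁ (base (qf⇒ qf≐ qf≐)))) ∅ nil-case cons-case Y)
          X)
        Z)
  where
  nil-case : Δ ⊢ all lst (all lst (nil ⌢ v1 ≐ v0 ⌢ v1 ⇒ nil ≐ v0))
  nil-case = ∀I (∀I (⇒I
    (≐-sym (⌢-identityˡ-unique (≐-trans (≐-sym (hyp (here refl))) ⌢-identityˡ)))))

  cons-cancel : ∀ {Γ} {Δ : List (Fm Γ)} {x y X Y Z} →
                Δ ⊢ cons x Y ⌢ X ≐ cons y Z ⌢ X → (Δ ⊢ Y ⌢ X ≐ Z ⌢ X → Δ ⊢ Y ≐ Z) →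
                Δ ⊢ cons x Y ≐ cons y Z
  cons-cancel h ih = cons-cong (cons-injectiveˡ e) (ih (cons-injectiveʳ e))
    where e = ≐-trans (≐-sym cons-⌢) (≐-trans h cons-⌢)

  cons-case : Δ ⊢ all lst (all ι (all lst (all lst (v3 ⌢ v1 ≐ v0 ⌢ v1 ⇒ v3 ≐ v0)) ⇒
                                  all lst (all lst (cons v2 v3 ⌢ v1 ≐ v0 ⌢ v1 ⇒ cons v2 v3 ≐ v0))))
  cons-case = ∀I (∀I (⇒I (∀I (∀I
    (induction (cons v2 v3 ⌢ v1 ≐ v0 ⌢ v1 ⇒ cons v2 v3 ≐ v0) (base (qf⇒ qf≐ qf≐)) (∅ ▸ v3 ▸ v2 ▸ v1)
      (⇒I (⊥̇-elim (nil≢cons (≐-sym (⌢-identityˡ-unique (≐-trans (hyp (here refl)) ⌢-identityˡ))))))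
      (∀I (∀I (⇒I (⇒I
        (cons-cancel (hyp (here refl)) (⇒E (∀E (∀E (hyp (there (there (here refl)))) v3) v1)))))))
      v0)))))

lemma4p6 : Proves T₁+IND∀₁ (∀* (lst ∷ lst ∷ lst ∷ []) (v1 ⌢ v2 ≐ v0 ⌢ v2 ⇒ v1 ≐ v0))
lemma4p6 = ∀I (∀I (∀I (⇒I (⌢-cancelʳ (hyp (here refl))))))
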